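{- Let $p\ge 3$ be a prime and $u\in\mathbb{Z}$ with $p\nmid u$. For each integer $v\ge 0$, let $S_{v}$ be the number of residue classes $x$ modulo $p^{v+1}$ for which the congruence $$ x^{2}+p^{v}u \equiv y^{2} \pmod{p^{v+1}} $$ has no solution $y\in\mathbb{Z}$. Then $S_{0}=\frac{p-\left(\frac{ -u}{p}\right)}{2}$, $S_{1}=p$, and $S_{v}=pS_{v-2}$ for all $v\ge 2$.
   Context: $\left(\frac{\cdot}{p}\right)$ denotes the Legendre symbol modulo the odd prime $p$. -}

module Defs where

open import Data.Nat using (ℕ; _^_)
open import Data.Integer using (ℤ; +_; _*_; _+_; _-_; -_; 0ℤ; 1ℤ; -1ℤ)
open import Data.Integer.Divisibility using (_∣_)
open import Data.Fin using (Fin; toℕ)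
open import Data.Product using (Σ; ∃; _×_)
open import Relation.Nullary using (¬_)
open import Function.Bundles using (_↔_)

_≡_[mod_] : ℤ → ℤ → ℤ → Set
a ≡ b [mod m ] = m ∣ (a - b)

IsSquareMod : ℤ → ℤ → Set
IsSquareMod p a = ∃ λ y → (y * y) ≡ a [mod p ]

data Legendre (p : ℕ) (a : ℤ) : ℤ → Set where
  leg-zero : (+ p) ∣ a → Legendre p a 0ℤ
  leg-res  : ¬ ((+ p) ∣ a) → IsSquareMod (+ p) a → Legendre p a 1ℤ
  leg-non  : ¬ ((+ p) ∣ a) → ¬ IsSquareMod (+ p) a → Legendre p a -1ℤ

-- the residue class x mod p^(v+1) (represented by 0 ≤ x < p^(v+1)) is "bad":
-- x² + p^v u ≡ y² (mod p^(v+1)) has no solution y ∈ ℤ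
Bad : (p : ℕ) (u : ℤ) (v : ℕ) → Fin (p ^ (ℕ.suc v)) → Set
Bad p u v x =
  ¬ (∃ λ (y : ℤ) →
       ((+ toℕ x) * (+ toℕ x) + (+ (p ^ v)) * u) ≡ (y * y) [mod (+ (p ^ ℕ.suc v)) ])

HasCount : (p : ℕ) (u : ℤ) (v : ℕ) (n : ℕ) → Set
HasCount p u v n = Fin n ↔ Σ (Fin (p ^ ℕ.suc v)) (Bad p u v)

{-# OPTIONS --safe #-}
module Submission where

-- Call x good at level v when x² + pᵛu is a square mod pᵛ⁺¹. For v ≥ 1 every x prime to p is
-- good, since (x + pᵛt)² ≡ x² + pᵛu as soon as 2xt ≡ u (mod p). For v = 1 no multiple of p is
-- good: y² ≡ x² + pu (mod p²) forces p ∣ y and then p ∣ u. For v ≥ 2 the multiple px is good at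
-- level v iff x is good at level v − 2 (a root is divisible by p, and p² cancels), and goodness at
-- level v − 2 depends only on x mod pᵛ⁻¹; hence S_v = p S_{v−2}. For v = 0 every x contributes
-- 2·[x² + u is a non-square] + #{y : y² ≡ x² + u} + [p ∣ x² + u] = 2. Summed over x, the middle
-- terms count the p − 1 solutions of x² − y² ≡ −u and the last ones the 1 + (−u/p) roots of −u,
-- so 2 S₀ + (p − 1) + 1 + (−u/p) = 2p.

open import Defs

module Counting where

  open import Data.Nat.Base
  open import Data.Nat.Properties
  open import Data.Nat.Divisibility using (_∣_; n∣m*n; ∣m+n∣m⇒∣n; >⇒∤)
  open import Data.Nat.Tactic.RingSolver using (solve-∀)
  open import Data.Bool.Base using (if_then_else_)
  open import Data.Fin.Base using (Fin; toℕ) renaming (zero to fzero; suc to fsuc)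
  open import Data.Fin.Properties using (+↔⊎)
  open import Data.Product.Base using (Σ; _,_)
  open import Data.Sum.Base using (_⊎_; inj₁; inj₂)
  open import Data.Sum.Function.Propositional using (_⊎-↔_)
  open import Function.Base using (_∘_)
  open import Function.Bundles using (_↔_; _⇔_; mk↔ₛ′; mk⇔; Equivalence)
  open import Function.Properties.Inverse using (↔-trans)
  open import Level using (0ℓ)
  open import Relation.Nullary.Decidable using (Dec; yes; no; does; _⊎-dec_; ¬?)
  open import Relation.Nullary.Negation using (¬_; contradiction)
  open import Relation.Unary using (Pred; Decidable; Irrelevant)
  open import Relation.Binary.PropositionalEquality
  open ≡-Reasoning

  ∑ : ℕ → (ℕ → ℕ) → ℕ
  ∑ zero    f = 0
  ∑ (suc n) f = f 0 + ∑ n (f ∘ suc)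

  syntax ∑ n (λ i → e) = ∑[ i < n ] e

  ∑-cong : ∀ n {f g : ℕ → ℕ} → (∀ {i} → i < n → f i ≡ g i) → ∑ n f ≡ ∑ n g
  ∑-cong zero    f≗g = refl
  ∑-cong (suc n) f≗g = cong₂ _+_ (f≗g z<s) (∑-cong n (f≗g ∘ s<s))

  ∑-const : ∀ n c → ∑[ i < n ] c ≡ n * c
  ∑-const zero    c = refl
  ∑-const (suc n) c = cong (c +_) (∑-const n c)

  ∑-distrib-+ : ∀ n (f g : ℕ → ℕ) → ∑[ i < n ] (f i + g i) ≡ ∑ n f + ∑ n g
  ∑-distrib-+ zero    f g = refl
  ∑-distrib-+ (suc n) f g = begin
    (f 0 + g 0) + ∑[ i < n ] (f (suc i) + g (suc i)) ≡⟨ cong ((f 0 + g 0) +_) (∑-distrib-+ n (f ∘ suc) (g ∘ suc)) ⟩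
    (f 0 + g 0) + (∑ n (f ∘ suc) + ∑ n (g ∘ suc))   ≡⟨ +-+-comm (f 0) (g 0) _ _ ⟩
    (f 0 + ∑ n (f ∘ suc)) + (g 0 + ∑ n (g ∘ suc))   ∎
    where
    +-+-comm : ∀ a b c d → (a + b) + (c + d) ≡ (a + c) + (b + d)
    +-+-comm = solve-∀

  *-distribˡ-∑ : ∀ n k (f : ℕ → ℕ) → ∑[ i < n ] (k * f i) ≡ k * ∑ n f
  *-distribˡ-∑ zero    k f = sym (*-zeroʳ k)
  *-distribˡ-∑ (suc n) k f =
    trans (cong (k * f 0 +_) (*-distribˡ-∑ n k (f ∘ suc))) (sym (*-distribˡ-+ k (f 0) _))

  ∑-++ : ∀ m n (f : ℕ → ℕ) → ∑ (m + n) f ≡ ∑ m f + ∑[ i < n ] f (m + i)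
  ∑-++ zero    n f = refl
  ∑-++ (suc m) n f = trans (cong (f 0 +_) (∑-++ m n (f ∘ suc))) (sym (+-assoc (f 0) _ _))

  ∑-snoc : ∀ n (f : ℕ → ℕ) → ∑ (suc n) f ≡ ∑ n f + f n
  ∑-snoc zero    f = +-comm (f 0) 0
  ∑-snoc (suc n) f = trans (cong (f 0 +_) (∑-snoc n (f ∘ suc))) (sym (+-assoc (f 0) _ _))

  ∑-comm : ∀ m n (F : ℕ → ℕ → ℕ) → ∑[ i < m ] ∑[ j < n ] F i j ≡ ∑[ j < n ] ∑[ i < m ] F i j
  ∑-comm zero    n F = sym (trans (∑-const n 0) (*-zeroʳ n))
  ∑-comm (suc m) n F = begin
    ∑ n (F 0) + ∑[ i < m ] ∑[ j < n ] F (suc i) j   ≡⟨ cong (∑ n (F 0) +_) (∑-comm m n (F ∘ suc)) ⟩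
    ∑ n (F 0) + ∑[ j < n ] ∑[ i < m ] F (suc i) j   ≡⟨ ∑-distrib-+ n (F 0) _ ⟨
    ∑[ j < n ] (F 0 j + ∑[ i < m ] F (suc i) j)     ∎

  ∑-periodic : ∀ k M (f : ℕ → ℕ) → (∀ i → f (M + i) ≡ f i) → ∑ (k * M) f ≡ k * ∑ M f
  ∑-periodic zero    M f per = refl
  ∑-periodic (suc k) M f per = begin
    ∑ (M + k * M) f                        ≡⟨ ∑-++ M (k * M) f ⟩
    ∑ M f + ∑[ i < k * M ] f (M + i)       ≡⟨ cong (∑ M f +_) (∑-cong (k * M) (λ {i} _ → per i)) ⟩
    ∑ M f + ∑ (k * M) f                    ≡⟨ cong (∑ M f +_) (∑-periodic k M f per) ⟩
    ∑ M f + k * ∑ M f                      ∎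

  ∑-blocks : ∀ k M (f : ℕ → ℕ) → ∑ (k * M) f ≡ ∑[ j < k ] ∑[ i < M ] f (j * M + i)
  ∑-blocks zero    M f = refl
  ∑-blocks (suc k) M f = begin
    ∑ (M + k * M) f                                       ≡⟨ ∑-++ M (k * M) f ⟩
    ∑ M f + ∑[ i < k * M ] f (M + i)                      ≡⟨ cong (∑ M f +_) (∑-blocks k M (λ i → f (M + i))) ⟩
    ∑ M f + ∑[ j < k ] ∑[ i < M ] f (M + (j * M + i))     ≡⟨ cong (∑ M f +_) (∑-cong k (λ {j} _ → ∑-cong M (λ {i} _ →
                                                               cong f (sym (+-assoc M (j * M) i))))) ⟩
    ∑ M f + ∑[ j < k ] ∑[ i < M ] f (suc j * M + i)       ∎

  ∑-rotate : ∀ n (f : ℕ → ℕ) → (∀ i → f (n + i) ≡ f i) → ∑[ i < n ] f (suc i) ≡ ∑ n f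
  ∑-rotate zero    f per = refl
  ∑-rotate (suc n) f per = begin
    ∑[ i < suc n ] f (suc i)         ≡⟨ ∑-snoc n (f ∘ suc) ⟩
    ∑ n (f ∘ suc) + f (suc n)        ≡⟨ cong (λ x → ∑ n (f ∘ suc) + f x) (+-identityʳ (suc n)) ⟨
    ∑ n (f ∘ suc) + f (suc n + 0)    ≡⟨ cong (∑ n (f ∘ suc) +_) (per 0) ⟩
    ∑ n (f ∘ suc) + f 0              ≡⟨ +-comm (∑ n (f ∘ suc)) (f 0) ⟩
    f 0 + ∑ n (f ∘ suc)              ∎

  ∑-shift : ∀ n c (f : ℕ → ℕ) → (∀ i → f (n + i) ≡ f i) → ∑[ i < n ] f (c + i) ≡ ∑ n f
  ∑-shift n zero    f per = refl
  ∑-shift n (suc c) f per = begin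
    ∑[ i < n ] f (suc c + i)      ≡⟨ ∑-cong n (λ {i} _ → cong f (+-suc c i)) ⟨
    ∑[ i < n ] f (c + suc i)      ≡⟨ ∑-rotate n (λ i → f (c + i)) per′ ⟩
    ∑[ i < n ] f (c + i)          ≡⟨ ∑-shift n c f per ⟩
    ∑ n f                         ∎
    where
    per′ : ∀ i → f (c + (n + i)) ≡ f (c + i)
    per′ i = trans (cong f (+-comm-middle c n i)) (per (c + i))
      where
      +-comm-middle : ∀ a b d → a + (b + d) ≡ b + (a + d)
      +-comm-middle = solve-∀

  𝟙 : ∀ {A : Set} → Dec A → ℕ
  𝟙 a? = if does a? then 1 else 0

  𝟙-cong : ∀ {A B : Set} → A ⇔ B → (a? : Dec A) (b? : Dec B) → 𝟙 a? ≡ 𝟙 b?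
  𝟙-cong A⇔B (yes a) (yes b) = refl
  𝟙-cong A⇔B (yes a) (no ¬b) = contradiction (Equivalence.to A⇔B a) ¬b
  𝟙-cong A⇔B (no ¬a) (yes b) = contradiction (Equivalence.from A⇔B b) ¬a
  𝟙-cong A⇔B (no ¬a) (no ¬b) = refl

  𝟙-yes : ∀ {A : Set} (a? : Dec A) → A → 𝟙 a? ≡ 1
  𝟙-yes (yes _) a = refl
  𝟙-yes (no ¬a) a = contradiction a ¬a

  𝟙-no : ∀ {A : Set} (a? : Dec A) → ¬ A → 𝟙 a? ≡ 0
  𝟙-no (yes a) ¬a = contradiction a ¬a
  𝟙-no (no _)  ¬a = refl

  count : ∀ {P : Pred ℕ 0ℓ} → Decidable P → ℕ → ℕ
  count P? n = ∑[ i < n ] 𝟙 (P? i)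

  variable
    P Q : Pred ℕ 0ℓ

  count-cong : (P? : Decidable P) (Q? : Decidable Q) → ∀ n → (∀ {i} → i < n → P i ⇔ Q i) → count P? n ≡ count Q? n
  count-cong P? Q? n P⇔Q = ∑-cong n (λ i<n → 𝟙-cong (P⇔Q i<n) (P? _) (Q? _))

  count-none : (P? : Decidable P) → ∀ n → (∀ {i} → i < n → ¬ P i) → count P? n ≡ 0
  count-none P? n ¬P = trans (∑-cong n (λ i<n → 𝟙-no (P? _) (¬P i<n))) (trans (∑-const n 0) (*-zeroʳ n))

  count-all : (P? : Decidable P) → ∀ n → (∀ {i} → i < n → P i) → count P? n ≡ n
  count-all P? n all = trans (∑-cong n (λ i<n → 𝟙-yes (P? _) (all i<n))) (trans (∑-const n 1) (*-identityʳ n))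

  count-periodic : (P? : Decidable P) → ∀ k M → (∀ i → P (M + i) ⇔ P i) → count P? (k * M) ≡ k * count P? M
  count-periodic P? k M per = ∑-periodic k M (λ i → 𝟙 (P? i)) (λ i → 𝟙-cong (per i) (P? _) (P? _))

  count-shift : (P? : Decidable P) → ∀ n c → (∀ i → P (n + i) ⇔ P i) → count (λ i → P? (c + i)) n ≡ count P? n
  count-shift P? n c per = ∑-shift n c (λ i → 𝟙 (P? i)) (λ i → 𝟙-cong (per i) (P? _) (P? _))

  count-multiples : (P? : Decidable P) → ∀ k m .{{_ : NonZero m}} → (∀ {i} → P i → m ∣ i) →
                    count P? (k * m) ≡ count (λ j → P? (j * m)) k
  count-multiples P? k m@(suc m′) P⇒m∣ = trans (∑-blocks k m (λ i → 𝟙 (P? i))) (∑-cong k (λ {j} _ → block j))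
    where
    block : ∀ j → ∑[ i < m ] 𝟙 (P? (j * m + i)) ≡ 𝟙 (P? (j * m))
    block j = begin
      𝟙 (P? (j * m + 0)) + ∑[ i < m′ ] 𝟙 (P? (j * m + suc i))   ≡⟨ cong₂ _+_ (cong (𝟙 ∘ P?) (+-identityʳ (j * m)))
                                                                      (count-none (P? ∘ (j * m +_) ∘ suc) m′
                                                                        (λ i<m′ Pi → >⇒∤ (s<s i<m′) (∣m+n∣m⇒∣n (P⇒m∣ Pi) (n∣m*n j)))) ⟩
      𝟙 (P? (j * m)) + 0                                         ≡⟨ +-identityʳ _ ⟩
      𝟙 (P? (j * m))                                             ∎

  count-complement : (P? : Decidable P) → ∀ n → count P? n + count (¬? ∘ P?) n ≡ n
  count-complement P? n = begin
    count P? n + count (¬? ∘ P?) n            ≡⟨ ∑-distrib-+ n (𝟙 ∘ P?) (𝟙 ∘ ¬? ∘ P?) ⟨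
    ∑[ i < n ] (𝟙 (P? i) + 𝟙 (¬? (P? i)))     ≡⟨ ∑-cong n (λ {i} _ → 𝟙+𝟙¬ (P? i)) ⟩
    ∑[ i < n ] 1                              ≡⟨ ∑-const n 1 ⟩
    n * 1                                     ≡⟨ *-identityʳ n ⟩
    n                                         ∎
    where
    𝟙+𝟙¬ : ∀ {A : Set} (a? : Dec A) → 𝟙 a? + 𝟙 (¬? a?) ≡ 1
    𝟙+𝟙¬ (yes _) = refl
    𝟙+𝟙¬ (no _)  = refl

  count-≡ : ∀ {a n} → a < n → count (_≟ a) n ≡ 1
  count-≡ {zero}  {suc n} _ = cong suc (count-none (λ i → suc i ≟ 0) n (λ _ ()))
  count-≡ {suc a} {suc n} (s<s a<n) =
    trans (count-cong (λ i → suc i ≟ suc a) (_≟ a) n (λ _ → mk⇔ suc-injective (cong suc))) (count-≡ a<n)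

  count-⊎ : (P? : Decidable P) (Q? : Decidable Q) → ∀ n → (∀ {i} → P i → ¬ Q i) →
            count (λ i → P? i ⊎-dec Q? i) n ≡ count P? n + count Q? n
  count-⊎ {P = P} {Q = Q} P? Q? n disjoint = trans (∑-cong n (λ {i} _ → 𝟙-⊎ (P? i) (Q? i))) (∑-distrib-+ n _ _)
    where
    𝟙-⊎ : ∀ {i} (p? : Dec (P i)) (q? : Dec (Q i)) → 𝟙 (p? ⊎-dec q?) ≡ 𝟙 p? + 𝟙 q?
    𝟙-⊎ (yes p) (yes q) = contradiction q (disjoint p)
    𝟙-⊎ (yes p) (no _)  = refl
    𝟙-⊎ (no _)  (yes q) = refl
    𝟙-⊎ (no _)  (no _)  = refl

  count-singleton : (P? : Decidable P) → ∀ {a n} → a < n → (∀ {i} → i < n → P i ⇔ i ≡ a) → count P? n ≡ 1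
  count-singleton P? a<n P⇔≡a = trans (count-cong P? (_≟ _) _ P⇔≡a) (count-≡ a<n)

  count-pair : (P? : Decidable P) → ∀ {a b n} → a ≢ b → a < n → b < n →
               (∀ {i} → i < n → P i ⇔ (i ≡ a ⊎ i ≡ b)) → count P? n ≡ 2
  count-pair P? {a} {b} {n} a≢b a<n b<n P⇔≡a⊎≡b = begin
    count P? n                                       ≡⟨ count-cong P? (λ i → (i ≟ a) ⊎-dec (i ≟ b)) n P⇔≡a⊎≡b ⟩
    count (λ i → (i ≟ a) ⊎-dec (i ≟ b)) n            ≡⟨ count-⊎ (_≟ a) (_≟ b) n (λ { refl refl → a≢b refl }) ⟩
    count (_≟ a) n + count (_≟ b) n                  ≡⟨ cong₂ _+_ (count-≡ a<n) (count-≡ b<n) ⟩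
    2                                                ∎

  count↔ : (P? : Decidable P) → Irrelevant P → ∀ n → Fin (count P? n) ↔ Σ (Fin n) (P ∘ toℕ)
  count↔ P? irr zero    = mk↔ₛ′ (λ ()) (λ ()) (λ ()) (λ ())
  count↔ {P = P} P? irr (suc n) = ↔-trans +↔⊎ (↔-trans (𝟙↔ (P? 0) irr ⊎-↔ count↔ (P? ∘ suc) irr n) split)
    where
    𝟙↔ : ∀ {A : Set} (a? : Dec A) → (∀ (a b : A) → a ≡ b) → Fin (𝟙 a?) ↔ A
    𝟙↔ (yes a) irrA = mk↔ₛ′ (λ _ → a) (λ _ → fzero) (irrA a) (λ { fzero → refl ; (fsuc ()) })
    𝟙↔ (no ¬a) irrA = mk↔ₛ′ (λ ()) (λ a → contradiction a ¬a) (λ a → contradiction a ¬a) (λ ())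
    split : (P 0 ⊎ Σ (Fin n) (P ∘ suc ∘ toℕ)) ↔ Σ (Fin (suc n)) (P ∘ toℕ)
    split = mk↔ₛ′ to from (λ { (fzero , _) → refl ; (fsuc _ , _) → refl }) (λ { (inj₁ _) → refl ; (inj₂ _) → refl })
      where
      to : P 0 ⊎ Σ (Fin n) (P ∘ suc ∘ toℕ) → Σ (Fin (suc n)) (P ∘ toℕ)
      to (inj₁ p)       = fzero , p
      to (inj₂ (i , p)) = fsuc i , p
      from : Σ (Fin (suc n)) (P ∘ toℕ) → P 0 ⊎ Σ (Fin n) (P ∘ suc ∘ toℕ)
      from (fzero  , p) = inj₁ p
      from (fsuc i , p) = inj₂ (i , p)

module Residues where

  open Counting

  open import Data.Nat.Base as ℕ using (ℕ; zero; suc; NonZero; _^_)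
  import Data.Nat.Properties as ℕ
  import Data.Nat.Divisibility as ℕ
  open import Data.Nat.Primality using (Prime; euclidsLemma; prime⇒nonZero; prime⇒irreducible)
  open import Data.Nat.Coprimality using (prime⇒coprime; coprime-Bézout)
  open import Data.Nat.GCD using (module Bézout)
  open import Data.Integer.Base as ℤ using (ℤ; +_; _+_; _*_; _-_; -_; 0ℤ; 1ℤ)
  open import Data.Integer.Properties
    using ( +-identityʳ; +-identityˡ; *-identityˡ; *-comm; neg-involutive; neg-distribˡ-*
          ; +-injective; i-j≡0⇒i≡j; ∣i∣≡0⇒i≡0; m-n≡m⊖n; ∣m⊝n∣≤m⊔n; abs-*; pos-+; pos-* )
  open import Data.Integer.DivMod using (_%ℕ_; _/ℕ_; n%ℕd<d; a≡a%ℕn+[a/ℕn]*n)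
  open import Data.Integer.Divisibility.Signed
  open import Data.Integer.Tactic.RingSolver using (solve-∀)
  open import Data.Fin.Base using (Fin; toℕ; fromℕ<)
  open import Data.Fin.Properties using (any?; toℕ-fromℕ<)
  open import Data.Product.Base using (∃; _,_)
  open import Data.Sum.Base as Sum using (_⊎_; inj₁; inj₂)
  open import Function.Base using (_∘_)
  open import Function.Bundles using (_⇔_; mk⇔; Equivalence)
  open import Function.Properties.Equivalence using () renaming (refl to ⇔-refl; sym to ⇔-sym; trans to ⇔-trans)
  open import Function.Related.TypeIsomorphisms using (¬-cong-⇔)
  open import Relation.Nullary.Decidable using (Dec; yes; no; map′; ¬?; decidable-stable)
  open import Relation.Nullary.Negation using (¬_; contradiction)
  open import Relation.Binary.PropositionalEquality
  open ≡-Reasoning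

  pos-+*≡* : ∀ a b c d e → a ℕ.+ b ℕ.* c ≡ d ℕ.* e → + a + + b * + c ≡ + d * + e
  pos-+*≡* a b c d e eq = begin
    + a + + b * + c    ≡⟨ cong (λ z → + a + z) (pos-* b c) ⟨
    + a + + (b ℕ.* c)  ≡⟨ pos-+ a (b ℕ.* c) ⟨
    + (a ℕ.+ b ℕ.* c)  ≡⟨ cong +_ eq ⟩
    + (d ℕ.* e)        ≡⟨ pos-* d e ⟩
    + d * + e          ∎

  m∣n∧n<m⇒n≡0 : ∀ {m n} → m ℕ.∣ n → n ℕ.< m → n ≡ 0
  m∣n∧n<m⇒n≡0 {n = zero}  _   _   = refl
  m∣n∧n<m⇒n≡0 {n = suc _} m∣n n<m = contradiction m∣n (ℕ.>⇒∤ n<m)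

  ∣-<⇒≡ : ∀ {m x y} → x ℕ.< m → y ℕ.< m → + m ∣ + x - + y → x ≡ y
  ∣-<⇒≡ {m} {x} {y} x<m y<m m∣x-y = +-injective (i-j≡0⇒i≡j (+ x) (+ y) (∣i∣≡0⇒i≡0 ∣x-y∣≡0))
    where
    ∣x-y∣<m : ℤ.∣ + x - + y ∣ ℕ.< m
    ∣x-y∣<m = subst (ℕ._< m) (cong ℤ.∣_∣ (sym (m-n≡m⊖n x y)))
                    (ℕ.≤-<-trans (∣m⊝n∣≤m⊔n x y) (ℕ.⊔-pres-<m x<m y<m))
    ∣x-y∣≡0 : ℤ.∣ + x - + y ∣ ≡ 0
    ∣x-y∣≡0 = m∣n∧n<m⇒n≡0 (∣⇒∣ᵤ m∣x-y) ∣x-y∣<m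

  ∣-%ℕ : ∀ a m .{{_ : NonZero m}} → + m ∣ a - + (a %ℕ m)
  ∣-%ℕ a m = divides (a /ℕ m) (begin
    a - r                     ≡⟨ cong (_- r) (a≡a%ℕn+[a/ℕn]*n a m) ⟩
    (r + (a /ℕ m) * + m) - r  ≡⟨ cancel r (a /ℕ m) (+ m) ⟩
    (a /ℕ m) * + m            ∎)
    where
    r = + (a %ℕ m)
    cancel : ∀ r q m → (r + q * m) - r ≡ q * m
    cancel = solve-∀

  ∣-m⇒∣m : ∀ {d} m → d ∣ - m → d ∣ m
  ∣-m⇒∣m {d} m d∣-m = subst (d ∣_) (neg-involutive m) (∣m⇒∣-m d∣-m)

  ∣m-n⇒∣n-m : ∀ {d} m n → d ∣ m - n → d ∣ n - m
  ∣m-n⇒∣n-m {d} m n d∣m-n = subst (d ∣_) (negate m n) (∣m⇒∣-m d∣m-n)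
    where
    negate : ∀ m n → - (m - n) ≡ n - m
    negate = solve-∀

  ∣m-n∣n⇒∣m : ∀ {d} m n → d ∣ m - n → d ∣ n → d ∣ m
  ∣m-n∣n⇒∣m m n d∣m-n d∣n = ∣m+n∣n⇒∣m d∣m-n (∣m⇒∣-m d∣n)

  ∣m-n⇒∣m*m-n*n : ∀ {d} m n → d ∣ m - n → d ∣ m * m - n * n
  ∣m-n⇒∣m*m-n*n {d} m n d∣m-n = subst (d ∣_) (difference-of-squares m n) (∣m⇒∣m*n (m + n) d∣m-n)
    where
    difference-of-squares : ∀ m n → (m - n) * (m + n) ≡ m * m - n * n
    difference-of-squares = solve-∀

  ∣⇒*∣* : ∀ {d m} → d ∣ m → d * d ∣ m * m
  ∣⇒*∣* {d} {m} d∣m = ∣-trans (*-monoʳ-∣ d d∣m) (*-monoˡ-∣ m d∣m)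

  ∣²-resp : ∀ {m} a b c → m ∣ a - b → m ∣ a * a - c → m ∣ b * b - c
  ∣²-resp {m} a b c m∣a-b m∣a²-c =
    subst (m ∣_) (rearrange a b c) (∣m∣n⇒∣m-n m∣a²-c (∣m-n⇒∣m*m-n*n a b m∣a-b))
    where
    rearrange : ∀ a b c → (a * a - c) - (a * a - b * b) ≡ b * b - c
    rearrange = solve-∀

  ∣²-cong : ∀ {m} a b c → m ∣ a - b → (m ∣ a * a - c) ⇔ (m ∣ b * b - c)
  ∣²-cong a b c m∣a-b = mk⇔ (∣²-resp a b c m∣a-b) (∣²-resp b a c (∣m-n⇒∣n-m a b m∣a-b))

  -- IsSquareMod with signed divisibility, for which the library provides the algebra.
  SquareMod : ℤ → ℤ → Set
  SquareMod m a = ∃ λ y → m ∣ y * y - a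

  SquareMod-resp : ∀ {m a b} → m ∣ a - b → SquareMod m a → SquareMod m b
  SquareMod-resp {m} {a} {b} m∣a-b (y , m∣y²-a) =
    y , subst (m ∣_) (rearrange (y * y) a b) (∣m∣n⇒∣m+n m∣y²-a m∣a-b)
    where
    rearrange : ∀ s a b → (s - a) + (a - b) ≡ s - b
    rearrange = solve-∀

  SquareMod-shift : ∀ {m} x y c → m ∣ x - y → SquareMod m (x * x + c) ⇔ SquareMod m (y * y + c)
  SquareMod-shift {m} x y c m∣x-y =
    mk⇔ (SquareMod-resp (m∣ x y m∣x-y)) (SquareMod-resp (m∣ y x (∣m-n⇒∣n-m x y m∣x-y)))
    where
    rearrange : ∀ x y c → x * x - y * y ≡ (x * x + c) - (y * y + c)
    rearrange = solve-∀
    m∣ : ∀ x y → m ∣ x - y → m ∣ (x * x + c) - (y * y + c)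
    m∣ x y m∣x-y = subst (m ∣_) (rearrange x y c) (∣m-n⇒∣m*m-n*n x y m∣x-y)

  SquareMod? : ∀ m .{{_ : NonZero m}} a → Dec (SquareMod (+ m) a)
  SquareMod? m a = map′ (λ (y , m∣y²-a) → + toℕ y , m∣y²-a) reduce (any? (λ y → + m ∣? + toℕ y * + toℕ y - a))
    where
    reduce : SquareMod (+ m) a → ∃ λ (y : Fin m) → + m ∣ + toℕ y * + toℕ y - a
    reduce (y , m∣y²-a) = fromℕ< y%m<m ,
      subst (λ r → + m ∣ + r * + r - a) (sym (toℕ-fromℕ< y%m<m)) (∣²-resp y _ a (∣-%ℕ y m) m∣y²-a)
      where
      y%m<m = n%ℕd<d y m

  module _ {p : ℕ} (p-prime : Prime p) where

    private instance
      p≢0 : NonZero p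
      p≢0 = prime⇒nonZero p-prime

    euclidsLemmaℤ : ∀ a b → + p ∣ a * b → + p ∣ a ⊎ + p ∣ b
    euclidsLemmaℤ a b p∣ab =
      Sum.map ∣ᵤ⇒∣ ∣ᵤ⇒∣ (euclidsLemma ℤ.∣ a ∣ ℤ.∣ b ∣ p-prime (subst (p ℕ.∣_) (abs-* a b) (∣⇒∣ᵤ p∣ab)))

    ∣*∣⇒∣ : ∀ {a} → + p ∣ a * a → + p ∣ a
    ∣*∣⇒∣ {a} p∣a² = Sum.reduce (euclidsLemmaℤ a a p∣a²)

    ∣+<⇒≡0 : ∀ {x} → x ℕ.< p → + p ∣ + x → x ≡ 0
    ∣+<⇒≡0 {x} x<p p∣x = ∣-<⇒≡ x<p (ℕ.>-nonZero⁻¹ p) (subst (+ p ∣_) (sym (+-identityʳ (+ x))) p∣x)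

    ∃-inverse-< : ∀ {r} .{{_ : NonZero r}} → r ℕ.< p → ∃ λ t → + p ∣ + r * t - 1ℤ
    ∃-inverse-< {r} r<p with coprime-Bézout (prime⇒coprime p-prime r<p)
    ... | Bézout.+- x y 1+yr≡xp = - + y , divides (- + x) (begin
      + r * - + y - 1ℤ      ≡⟨ negate (+ r) (+ y) ⟩
      - (1ℤ + + y * + r)    ≡⟨ cong -_ (pos-+*≡* 1 y r x p 1+yr≡xp) ⟩
      - (+ x * + p)         ≡⟨ neg-distribˡ-* (+ x) (+ p) ⟩
      - + x * + p           ∎)
      where
      negate : ∀ r y → r * - y - 1ℤ ≡ - (1ℤ + y * r)
      negate = solve-∀
    ... | Bézout.-+ x y 1+xp≡yr = + y , divides (+ x) (begin
      + r * + y - 1ℤ         ≡⟨ cong (_- 1ℤ) (trans (*-comm (+ r) (+ y)) (sym (pos-+*≡* 1 x p y r 1+xp≡yr))) ⟩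
      (1ℤ + + x * + p) - 1ℤ  ≡⟨ cancel (+ x * + p) ⟩
      + x * + p              ∎)
      where
      cancel : ∀ a → (1ℤ + a) - 1ℤ ≡ a
      cancel = solve-∀

    ∃-inverse : ∀ {a} → ¬ + p ∣ a → ∃ λ t → + p ∣ a * t - 1ℤ
    ∃-inverse {a} p∤a with a %ℕ p | n%ℕd<d a p | ∣-%ℕ a p
    ... | zero      | _   | p∣a-0 = contradiction (subst (+ p ∣_) (+-identityʳ a) p∣a-0) p∤a
    ... | r@(suc _) | r<p | p∣a-r with ∃-inverse-< r<p
    ...   | t , p∣rt-1 = t , subst (+ p ∣_) (split a (+ r) t) (∣m∣n⇒∣m+n (∣m⇒∣m*n t p∣a-r) p∣rt-1)
      where
      split : ∀ a r t → (a - r) * t + (r * t - 1ℤ) ≡ a * t - 1ℤ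
      split = solve-∀

    ∃-solution : ∀ {a} → ¬ + p ∣ a → ∀ c → ∃ λ t → + p ∣ a * t - c
    ∃-solution {a} p∤a c = scale (∃-inverse p∤a)
      where
      rearrange : ∀ a t c → (a * t - 1ℤ) * c ≡ a * (t * c) - c
      rearrange = solve-∀
      scale : (∃ λ t → + p ∣ a * t - 1ℤ) → ∃ λ t → + p ∣ a * t - c
      scale (t , p∣at-1) = t * c , subst (+ p ∣_) (rearrange a t c) (∣m⇒∣m*n c p∣at-1)

    count-linear : ∀ {b} → ¬ + p ∣ b → ∀ c → count (λ x → + p ∣? b * + x - c) p ≡ 1
    count-linear {b} p∤b c = from-solution (∃-solution p∤b c)
      where
      from-solution : (∃ λ t → + p ∣ b * t - c) → count (λ x → + p ∣? b * + x - c) p ≡ 1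
      from-solution (t , p∣bt-c) =
        count-singleton (λ x → + p ∣? b * + x - c) x₀<p (λ x<p → mk⇔ (unique x<p) (λ { refl → p∣bx₀-c }))
        where
        x₀ = t %ℕ p
        x₀<p = n%ℕd<d t p
        rearrange : ∀ b t x c → (b * t - c) - b * (t - x) ≡ b * x - c
        rearrange = solve-∀
        p∣bx₀-c : + p ∣ b * + x₀ - c
        p∣bx₀-c = subst (+ p ∣_) (rearrange b t (+ x₀) c) (∣m∣n⇒∣m-n p∣bt-c (∣n⇒∣m*n b (∣-%ℕ t p)))
        difference : ∀ b x y c → (b * x - c) - (b * y - c) ≡ b * (x - y)
        difference = solve-∀
        unique : ∀ {x} → x ℕ.< p → + p ∣ b * + x - c → x ≡ x₀
        unique {x} x<p p∣bx-c = Sum.[ (λ p∣b → contradiction p∣b p∤b) , ∣-<⇒≡ x<p x₀<p ]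
          (euclidsLemmaℤ b (+ x - + x₀) (subst (+ p ∣_) (difference b (+ x) (+ x₀) c) (∣m∣n⇒∣m-n p∣bx-c p∣bx₀-c)))

    SquareMod-lift : ∀ {x q} → ¬ + p ∣ + 2 * x → + p ∣ q → ∀ c → SquareMod (+ p * q) (x * x + q * c)
    SquareMod-lift {x} {q} p∤2x p∣q c = lift (∃-solution p∤2x c)
      where
      expand : ∀ x q t c → q * (+ 2 * x * t - c) + q * q * t * t ≡ (x + q * t) * (x + q * t) - (x * x + q * c)
      expand = solve-∀
      lift : (∃ λ t → + p ∣ + 2 * x * t - c) → SquareMod (+ p * q) (x * x + q * c)
      lift (t , p∣2xt-c) = x + q * t , subst (+ p * q ∣_) (expand x q t c) (∣m∣n⇒∣m+n pq∣q[2xt-c] pq∣qqtt)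
        where
        pq∣q[2xt-c] : + p * q ∣ q * (+ 2 * x * t - c)
        pq∣q[2xt-c] = subst (_∣ q * (+ 2 * x * t - c)) (*-comm q (+ p)) (*-monoʳ-∣ q p∣2xt-c)
        pq∣qqtt : + p * q ∣ q * q * t * t
        pq∣qqtt = ∣m⇒∣m*n t (∣m⇒∣m*n t (*-monoˡ-∣ q p∣q))

    ¬SquareMod-p*p : ∀ {x c} → + p ∣ x → ¬ + p ∣ c → ¬ SquareMod (+ p * + p) (x * x + + p * c)
    ¬SquareMod-p*p {x} {c} p∣x p∤c (y , pp∣y²-[x²+pc]) = p∤c (*-cancelˡ-∣ (+ p) pp∣pc)
      where
      p∣y : + p ∣ y
      p∣y = ∣*∣⇒∣ (∣m-n∣n⇒∣m (y * y) (x * x + + p * c)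
              (∣-trans (∣m⇒∣m*n (+ p) ∣-refl) pp∣y²-[x²+pc]) (∣m∣n⇒∣m+n (∣m⇒∣m*n x p∣x) (∣m⇒∣m*n c ∣-refl)))
      isolate : ∀ y x r → (y * y - x * x) - (y * y - (x * x + r)) ≡ r
      isolate = solve-∀
      pp∣pc : + p * + p ∣ + p * c
      pp∣pc = subst (+ p * + p ∣_) (isolate y x (+ p * c))
                (∣m∣n⇒∣m-n (∣m∣n⇒∣m-n (∣⇒*∣* p∣y) (∣⇒*∣* p∣x)) pp∣y²-[x²+pc])

    SquareMod-*p² : ∀ m a → SquareMod (+ p * (+ p * m)) (+ p * (+ p * a)) ⇔ SquareMod m a
    SquareMod-*p² m a = mk⇔ descend ascend
      where
      scale : ∀ q y a → q * (q * (y * y - a)) ≡ (q * y) * (q * y) - q * (q * a)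
      scale = solve-∀
      ascend : SquareMod m a → SquareMod (+ p * (+ p * m)) (+ p * (+ p * a))
      ascend (y , m∣y²-a) = + p * y , subst (+ p * (+ p * m) ∣_) (scale (+ p) y a) (*-monoʳ-∣ (+ p) (*-monoʳ-∣ (+ p) m∣y²-a))
      descend : SquareMod (+ p * (+ p * m)) (+ p * (+ p * a)) → SquareMod m a
      descend (y , ppm∣y²-ppa) = root (∣*∣⇒∣ (∣m-n∣n⇒∣m (y * y) (+ p * (+ p * a))
                                          (∣-trans (∣m⇒∣m*n (+ p * m) ∣-refl) ppm∣y²-ppa) (∣m⇒∣m*n (+ p * a) ∣-refl)))
        where
        commute : ∀ z q → (q * z) * (q * z) ≡ (z * q) * (z * q)
        commute = solve-∀
        root : + p ∣ y → SquareMod m a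
        root (divides z refl) = z , *-cancelˡ-∣ (+ p) (*-cancelˡ-∣ (+ p) (subst (+ p * (+ p * m) ∣_)
          (sym (trans (scale (+ p) z a) (cong (_- + p * (+ p * a)) (commute z (+ p))))) ppm∣y²-ppa))

    roots : ℤ → ℕ
    roots c = count (λ y → + p ∣? + y * + y - c) p

    roots-nonsquare : ∀ {c} → ¬ SquareMod (+ p) c → roots c ≡ 0
    roots-nonsquare {c} ¬□ = count-none (λ y → + p ∣? + y * + y - c) p (λ {y} _ p∣y²-c → ¬□ (+ y , p∣y²-c))

    roots-zero : ∀ {c} → + p ∣ c → roots c ≡ 1
    roots-zero {c} p∣c = count-singleton (λ y → + p ∣? + y * + y - c) (ℕ.>-nonZero⁻¹ p) (λ y<p → mk⇔ (to y<p) from)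
      where
      to : ∀ {y} → y ℕ.< p → + p ∣ + y * + y - c → y ≡ 0
      to {y} y<p p∣y²-c = ∣+<⇒≡0 y<p (∣*∣⇒∣ (∣m-n∣n⇒∣m (+ y * + y) c p∣y²-c p∣c))
      from : ∀ {y} → y ≡ 0 → + p ∣ + y * + y - c
      from refl = subst (+ p ∣_) (sym (+-identityˡ (- c))) (∣m⇒∣-m p∣c)

    module _ (p>2 : 2 ℕ.< p) where

      p∤2* : ∀ {a} → ¬ + p ∣ a → ¬ + p ∣ + 2 * a
      p∤2* {a} p∤a p∣2a = Sum.[ (λ p∣2 → ℕ.>⇒∤ p>2 (∣⇒∣ᵤ p∣2)) , p∤a ] (euclidsLemmaℤ (+ 2) a p∣2a)

      ≢p∸ : ∀ {r} → r ℕ.≤ p → r ≢ p ℕ.∸ r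
      ≢p∸ {r} r≤p r≡p-r with prime⇒irreducible p-prime (ℕ.divides r p≡r*2)
        where
        p≡r*2 : p ≡ r ℕ.* 2
        p≡r*2 = begin
          p              ≡⟨ ℕ.m∸n+n≡m r≤p ⟨
          p ℕ.∸ r ℕ.+ r  ≡⟨ cong (ℕ._+ r) r≡p-r ⟨
          r ℕ.+ r        ≡⟨ cong (r ℕ.+_) (ℕ.+-identityʳ r) ⟨
          2 ℕ.* r        ≡⟨ ℕ.*-comm 2 r ⟩
          r ℕ.* 2        ∎
      ... | inj₁ ()
      ... | inj₂ refl = ℕ.<-irrefl refl p>2

      roots-square : ∀ {c} → SquareMod (+ p) c → ¬ + p ∣ c → roots c ≡ 2
      roots-square {c} (y , p∣y²-c) p∤c =
        count-pair (λ y → + p ∣? + y * + y - c) (≢p∸ (ℕ.<⇒≤ r<p)) r<p s<p (λ i<p → mk⇔ (to i<p) from)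
        where
        r = y %ℕ p
        r<p = n%ℕd<d y p
        s = p ℕ.∸ r
        p∣r²-c : + p ∣ + r * + r - c
        p∣r²-c = ∣²-resp y (+ r) c (∣-%ℕ y p) p∣y²-c
        0<r : 0 ℕ.< r
        0<r = ℕ.n≢0⇒n>0 λ r≡0 → p∤c (∣-m⇒∣m c
          (subst (+ p ∣_) (+-identityˡ (- c)) (subst (λ r → + p ∣ + r * + r - c) r≡0 p∣r²-c)))
        s<p : s ℕ.< p
        s<p = ℕ.∸-monoʳ-< 0<r (ℕ.<⇒≤ r<p)
        p∣s+r : + p ∣ + s + + r
        p∣s+r = subst (+ p ∣_) (trans (cong +_ (sym (ℕ.m∸n+n≡m (ℕ.<⇒≤ r<p)))) (pos-+ s r)) ∣-refl
        factor : ∀ i r c → (i * i - c) - (r * r - c) ≡ (i - r) * (i + r)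
        factor = solve-∀
        cancel : ∀ i s r → (i + r) - (s + r) ≡ i - s
        cancel = solve-∀
        to : ∀ {i} → i ℕ.< p → + p ∣ + i * + i - c → i ≡ r ⊎ i ≡ s
        to {i} i<p p∣i²-c = Sum.map (∣-<⇒≡ i<p r<p)
          (λ p∣i+r → ∣-<⇒≡ i<p s<p (subst (+ p ∣_) (cancel (+ i) (+ s) (+ r)) (∣m∣n⇒∣m-n p∣i+r p∣s+r)))
          (euclidsLemmaℤ (+ i - + r) (+ i + + r) (subst (+ p ∣_) (factor (+ i) (+ r) c) (∣m∣n⇒∣m-n p∣i²-c p∣r²-c)))
        negate : ∀ s r → - (s + r) ≡ - r - s
        negate = solve-∀
        square-neg : ∀ r c → r * r - c ≡ - r * - r - c
        square-neg = solve-∀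
        from : ∀ {i} → i ≡ r ⊎ i ≡ s → + p ∣ + i * + i - c
        from (inj₁ refl) = p∣r²-c
        from (inj₂ refl) = ∣²-resp (- + r) (+ s) c (subst (+ p ∣_) (negate (+ s) (+ r)) (∣m⇒∣-m p∣s+r))
                                   (subst (+ p ∣_) (square-neg (+ r) c) p∣r²-c)

      roots-Legendre : ∀ {a ε} → Legendre p a ε → + roots a ≡ 1ℤ + ε
      roots-Legendre (leg-zero p∣a)           = cong +_ (roots-zero (∣ᵤ⇒∣ p∣a))
      roots-Legendre (leg-res p∤a (y , y²≡a)) = cong +_ (roots-square (y , ∣ᵤ⇒∣ y²≡a) (p∤a ∘ ∣⇒∣ᵤ))
      roots-Legendre (leg-non _ ¬□)           = cong +_ (roots-nonsquare λ (y , p∣y²-a) → ¬□ (y , ∣⇒∣ᵤ p∣y²-a))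

      -- The number of square roots of c is 1 + (c/p), so every c contributes 2 in total.
      roots-balance : ∀ c → 2 ℕ.* 𝟙 (¬? (SquareMod? p c)) ℕ.+ roots c ℕ.+ 𝟙 (+ p ∣? c) ≡ 2
      roots-balance c = balance (SquareMod? p c) (+ p ∣? c)
        where
        balance : (□? : Dec (SquareMod (+ p) c)) (p∣c? : Dec (+ p ∣ c)) → 2 ℕ.* 𝟙 (¬? □?) ℕ.+ roots c ℕ.+ 𝟙 p∣c? ≡ 2
        balance (no ¬□) (yes p∣c) = contradiction (0ℤ , subst (+ p ∣_) (sym (+-identityˡ (- c))) (∣m⇒∣-m p∣c)) ¬□
        balance (no ¬□) (no _)    = cong (λ r → 2 ℕ.+ r ℕ.+ 0) (roots-nonsquare ¬□)
        balance (yes _) (yes p∣c) = cong (ℕ._+ 1) (roots-zero p∣c)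
        balance (yes □) (no p∤c)  = cong (ℕ._+ 0) (roots-square □ p∤c)

      -- Substituting y = a − x turns y² ≡ x² + u into the congruence −2a·x ≡ u − a², linear in x:
      -- it has exactly one solution for each a ≢ 0 and none for a ≡ 0.
      ∑-roots : ∀ {u} → ¬ + p ∣ u → ∑[ x < p ] roots (+ x * + x + u) ℕ.+ 1 ≡ p
      ∑-roots {u} p∤u = begin
        ∑[ x < p ] roots (+ x * + x + u) ℕ.+ 1              ≡⟨ cong (ℕ._+ 1) (∑-cong p roots≡) ⟩
        ∑[ x < p ] ∑[ a < p ] 𝟙 (+ p ∣? line a x) ℕ.+ 1     ≡⟨ cong (ℕ._+ 1) (∑-comm p p (λ x a → 𝟙 (+ p ∣? line a x))) ⟩
        ∑[ a < p ] count (λ x → + p ∣? line a x) p ℕ.+ 1    ≡⟨ cong (ℕ._+ 1) (∑-cong p lines) ⟩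
        count a≢0? p ℕ.+ 1                                  ≡⟨ cong (count a≢0? p ℕ.+_) (count-≡ (ℕ.>-nonZero⁻¹ p)) ⟨
        count a≢0? p ℕ.+ count (ℕ._≟ 0) p                   ≡⟨ ℕ.+-comm (count a≢0? p) _ ⟩
        count (ℕ._≟ 0) p ℕ.+ count a≢0? p                   ≡⟨ count-complement (ℕ._≟ 0) p ⟩
        p                                                   ∎
        where
        line : ℕ → ℕ → ℤ
        line a x = - (+ 2 * + a) * + x - (u - + a * + a)
        a≢0? = λ a → ¬? (a ℕ.≟ 0)
        roots≡ : ∀ {x} → x ℕ.< p → roots (+ x * + x + u) ≡ count (λ a → + p ∣? line a x) p
        roots≡ {x} x<p = begin
          roots c                            ≡⟨ count-shift root? p s periodic ⟨
          count (λ a → root? (s ℕ.+ a)) p    ≡⟨ count-cong (λ a → root? (s ℕ.+ a)) (λ a → + p ∣? line a x) p (λ {a} _ → shifted a) ⟩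
          count (λ a → + p ∣? line a x) p    ∎
          where
          c = + x * + x + u
          s = p ℕ.∸ x
          root? = λ y → + p ∣? + y * + y - c
          cancel : ∀ a b → (a + b) - b ≡ a
          cancel = solve-∀
          periodic : ∀ i → (+ p ∣ + (p ℕ.+ i) * + (p ℕ.+ i) - c) ⇔ (+ p ∣ + i * + i - c)
          periodic i = ∣²-cong (+ (p ℕ.+ i)) (+ i) c
            (subst (+ p ∣_) (sym (trans (cong (_- + i) (pos-+ p i)) (cancel (+ p) (+ i)))) ∣-refl)
          rearrange : ∀ s a x → (s + a) - (a - x) ≡ s + x
          rearrange = solve-∀
          p∣s+a-[a-x] : ∀ a → + p ∣ + (s ℕ.+ a) - (+ a - + x)
          p∣s+a-[a-x] a = subst (+ p ∣_) (sym (begin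
            + (s ℕ.+ a) - (+ a - + x)  ≡⟨ cong (_- (+ a - + x)) (pos-+ s a) ⟩
            (+ s + + a) - (+ a - + x)  ≡⟨ rearrange (+ s) (+ a) (+ x) ⟩
            + s + + x                  ≡⟨ pos-+ s x ⟨
            + (s ℕ.+ x)                ≡⟨ cong +_ (ℕ.m∸n+n≡m (ℕ.<⇒≤ x<p)) ⟩
            + p                        ∎)) ∣-refl
          expand : ∀ a x u → (a - x) * (a - x) - (x * x + u) ≡ - (+ 2 * a) * x - (u - a * a)
          expand = solve-∀
          shifted : ∀ a → (+ p ∣ + (s ℕ.+ a) * + (s ℕ.+ a) - c) ⇔ (+ p ∣ line a x)
          shifted a = subst (λ e → (+ p ∣ + (s ℕ.+ a) * + (s ℕ.+ a) - c) ⇔ (+ p ∣ e)) (expand (+ a) (+ x) u)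
                            (∣²-cong (+ (s ℕ.+ a)) (+ a - + x) c (p∣s+a-[a-x] a))
        line₀ : ∀ x u → - (+ 2 * 0ℤ) * x - (u - 0ℤ * 0ℤ) ≡ - u
        line₀ = solve-∀
        lines : ∀ {a} → a ℕ.< p → count (λ x → + p ∣? line a x) p ≡ 𝟙 (a≢0? a)
        lines {zero}  _   = count-none (λ x → + p ∣? line 0 x) p
                              (λ {x} _ p∣line → p∤u (∣-m⇒∣m u (subst (+ p ∣_) (line₀ (+ x) u) p∣line)))
        lines {suc a} a<p = count-linear (p∤2* (λ p∣a → contradiction (∣+<⇒≡0 a<p p∣a) λ ()) ∘ ∣-m⇒∣m _) (u - + suc a * + suc a)

  -- Bad p u v x with the residue x replaced by its representative toℕ x, so that count↔ applies.
  Badℕ : (p : ℕ) (u : ℤ) (v : ℕ) → ℕ → Set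
  Badℕ p u v n = ¬ ∃ λ (y : ℤ) → ((+ n) * (+ n) + (+ (p ^ v)) * u) ≡ (y * y) [mod (+ (p ^ suc v)) ]

  ≡-mod⇔SquareMod : ∀ m a → (∃ λ y → a ≡ y * y [mod m ]) ⇔ SquareMod m a
  ≡-mod⇔SquareMod m a = mk⇔ (λ (y , m∣a-y²) → y , ∣m-n⇒∣n-m a (y * y) (∣ᵤ⇒∣ m∣a-y²))
                             (λ (y , m∣y²-a) → y , ∣⇒∣ᵤ (∣m-n⇒∣n-m (y * y) a m∣y²-a))

  legendre-arith : ∀ B R Z P ε → + 2 * B + R + Z ≡ P * + 2 → R + 1ℤ ≡ P → Z ≡ 1ℤ + ε → + 2 * B ≡ P - ε
  legendre-arith B R .(1ℤ + ε) .(R + 1ℤ) ε total refl refl = begin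
    + 2 * B                                    ≡⟨ isolate B R ε ⟩
    (+ 2 * B + R + (1ℤ + ε)) - R - (1ℤ + ε)    ≡⟨ cong (λ t → t - R - (1ℤ + ε)) total ⟩
    (R + 1ℤ) * + 2 - R - (1ℤ + ε)              ≡⟨ simplify R ε ⟩
    (R + 1ℤ) - ε                               ∎
    where
    isolate : ∀ B R ε → + 2 * B ≡ (+ 2 * B + R + (1ℤ + ε)) - R - (1ℤ + ε)
    isolate = solve-∀
    simplify : ∀ R ε → (R + 1ℤ) * + 2 - R - (1ℤ + ε) ≡ (R + 1ℤ) - ε
    simplify = solve-∀

  module BadResidues {p : ℕ} (p-prime : Prime p) (p>2 : 2 ℕ.< p) {u : ℤ} (p∤u : ¬ + p ∣ u) where

    private instance
      p≢0 : NonZero p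
      p≢0 = prime⇒nonZero p-prime

    Bad⇔ : ∀ v n → Badℕ p u v n ⇔ (¬ SquareMod (+ (p ^ suc v)) (+ n * + n + + (p ^ v) * u))
    Bad⇔ v n = ¬-cong-⇔ (≡-mod⇔SquareMod _ _)

    Bad? : ∀ v n → Dec (Badℕ p u v n)
    Bad? v n = map′ (Equivalence.from (Bad⇔ v n)) (Equivalence.to (Bad⇔ v n))
                    (¬? (SquareMod? (p ^ suc v) {{ℕ.m^n≢0 p (suc v)}} _))

    S : ℕ → ℕ
    S v = count (Bad? v) (p ^ suc v)

    -- Irrelevance is refl: the library's ⊥ wraps an irrelevant field, so proofs of a negation are equal.
    hasCount : ∀ v → HasCount p u v (S v)
    hasCount v = count↔ (Bad? v) (λ _ _ → refl) (p ^ suc v)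

    Bad-periodic : ∀ v i → Badℕ p u v (p ^ suc v ℕ.+ i) ⇔ Badℕ p u v i
    Bad-periodic v i = ⇔-trans (Bad⇔ v (M ℕ.+ i))
      (⇔-trans (¬-cong-⇔ (SquareMod-shift (+ (M ℕ.+ i)) (+ i) (+ (p ^ v) * u) M∣M+i-i)) (⇔-sym (Bad⇔ v i)))
      where
      M = p ^ suc v
      cancel : ∀ a b → (a + b) - b ≡ a
      cancel = solve-∀
      M∣M+i-i : + M ∣ + (M ℕ.+ i) - + i
      M∣M+i-i = subst (+ M ∣_) (sym (trans (cong (_- + i) (pos-+ M i)) (cancel (+ M) (+ i)))) ∣-refl

    unit⇒¬Bad : ∀ v {n} → ¬ + p ∣ + n → ¬ Badℕ p u (suc v) n
    unit⇒¬Bad v {n} p∤n bad = Equivalence.to (Bad⇔ (suc v) n) bad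
      (subst (λ m → SquareMod m (+ n * + n + + (p ^ suc v) * u)) (sym (pos-* p (p ^ suc v)))
        (SquareMod-lift p-prime {+ n} (p∤2* p-prime p>2 p∤n) p∣pᵛ⁺¹ u))
      where
      p∣pᵛ⁺¹ : + p ∣ + (p ^ suc v)
      p∣pᵛ⁺¹ = divides (+ (p ^ v)) (trans (pos-* p (p ^ v)) (*-comm (+ p) _))

    Bad⇒p∣ : ∀ v {n} → Badℕ p u (suc v) n → p ℕ.∣ n
    Bad⇒p∣ v {n} bad = ∣⇒∣ᵤ (decidable-stable (+ p ∣? + n) (λ p∤n → unit⇒¬Bad v p∤n bad))

    Bad₁ : ∀ j → Badℕ p u 1 (j ℕ.* p)
    Bad₁ j = Equivalence.from (Bad⇔ 1 (j ℕ.* p))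
      (subst₂ (λ m q → ¬ SquareMod m (+ (j ℕ.* p) * + (j ℕ.* p) + q * u)) (sym p*p) (sym p*1)
        (¬SquareMod-p*p p-prime (divides (+ j) (pos-* j p)) p∤u))
      where
      p*1 : + (p ℕ.* 1) ≡ + p
      p*1 = cong +_ (ℕ.*-identityʳ p)
      p*p : + (p ℕ.* (p ℕ.* 1)) ≡ + p * + p
      p*p = trans (pos-* p (p ℕ.* 1)) (cong (+ p *_) p*1)

    Bad-scale : ∀ v j → Badℕ p u (suc (suc v)) (j ℕ.* p) ⇔ Badℕ p u v j
    Bad-scale v j = ⇔-trans (Bad⇔ (suc (suc v)) (j ℕ.* p))
      (⇔-trans (¬-cong-⇔ (subst₂ (λ m a → SquareMod m a ⇔ SquareMod (+ (p ^ suc v)) c) (sym modulus) (sym value)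
                                  (SquareMod-*p² p-prime (+ (p ^ suc v)) c)))
               (⇔-sym (Bad⇔ v j)))
      where
      c = + j * + j + + (p ^ v) * u
      modulus : + (p ^ suc (suc (suc v))) ≡ + p * (+ p * + (p ^ suc v))
      modulus = trans (pos-* p _) (cong (+ p *_) (pos-* p _))
      expand : ∀ j p q u → (j * p) * (j * p) + (p * (p * q)) * u ≡ p * (p * (j * j + q * u))
      expand = solve-∀
      value : + (j ℕ.* p) * + (j ℕ.* p) + + (p ^ suc (suc v)) * u ≡ + p * (+ p * c)
      value = begin
        + (j ℕ.* p) * + (j ℕ.* p) + + (p ^ suc (suc v)) * u
          ≡⟨ cong₂ (λ a b → a * a + b * u) (pos-* j p) (trans (pos-* p _) (cong (+ p *_) (pos-* p _))) ⟩
        (+ j * + p) * (+ j * + p) + (+ p * (+ p * + (p ^ v))) * u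
          ≡⟨ expand (+ j) (+ p) (+ (p ^ v)) u ⟩
        + p * (+ p * c)  ∎

    Bad₀⇔ : ∀ n → Badℕ p u 0 n ⇔ (¬ SquareMod (+ p) (+ n * + n + u))
    Bad₀⇔ n = subst₂ (λ m a → Badℕ p u 0 n ⇔ (¬ SquareMod m (+ n * + n + a)))
                     (cong +_ (ℕ.*-identityʳ p)) (*-identityˡ u) (Bad⇔ 0 n)

    S₁ : S 1 ≡ p
    S₁ = begin
      count (Bad? 1) (p ℕ.* (p ℕ.* 1))   ≡⟨ cong (count (Bad? 1) ∘ (p ℕ.*_)) (ℕ.*-identityʳ p) ⟩
      count (Bad? 1) (p ℕ.* p)           ≡⟨ count-multiples (Bad? 1) p p (Bad⇒p∣ 0) ⟩
      count (λ j → Bad? 1 (j ℕ.* p)) p   ≡⟨ count-all (λ j → Bad? 1 (j ℕ.* p)) p (λ {j} _ → Bad₁ j) ⟩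
      p                                  ∎

    S-step : ∀ v → S (suc (suc v)) ≡ p ℕ.* S v
    S-step v = begin
      count (Bad? v″) (p ℕ.* p ^ v″)           ≡⟨ cong (count (Bad? v″)) (ℕ.*-comm p _) ⟩
      count (Bad? v″) (p ^ v″ ℕ.* p)           ≡⟨ count-multiples (Bad? v″) (p ^ v″) p (Bad⇒p∣ (suc v)) ⟩
      count (λ j → Bad? v″ (j ℕ.* p)) (p ^ v″) ≡⟨ count-cong (λ j → Bad? v″ (j ℕ.* p)) (Bad? v) (p ^ v″) (λ {j} _ → Bad-scale v j) ⟩
      count (Bad? v) (p ℕ.* p ^ suc v)         ≡⟨ count-periodic (Bad? v) p (p ^ suc v) (Bad-periodic v) ⟩
      p ℕ.* S v                                ∎
      where
      v″ = suc (suc v)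

    S₀ : ∀ ε → Legendre p (- u) ε → + 2 * + S 0 ≡ + p - ε
    S₀ ε leg = subst (λ b → + 2 * + b ≡ + p - ε) (sym S₀≡B)
      (legendre-arith (+ B) (+ R) (+ Z) (+ p) ε (cast total)
        (trans (sym (pos-+ R 1)) (cong +_ (∑-roots p-prime p>2 p∤u)))
        (trans (cong +_ Z≡roots) (roots-Legendre p-prime p>2 leg)))
      where
      nonsquare root-count divisible : ℕ → ℕ
      nonsquare  x = 𝟙 (¬? (SquareMod? p (+ x * + x + u)))
      root-count x = roots p-prime (+ x * + x + u)
      divisible  x = 𝟙 (+ p ∣? + x * + x + u)
      B R Z : ℕ
      B = ∑ p nonsquare
      R = ∑ p root-count
      Z = ∑ p divisible
      S₀≡B : S 0 ≡ B
      S₀≡B = trans (cong (count (Bad? 0)) (ℕ.*-identityʳ p))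
                   (count-cong (Bad? 0) (λ x → ¬? (SquareMod? p (+ x * + x + u))) p (λ {x} _ → Bad₀⇔ x))
      total : 2 ℕ.* B ℕ.+ R ℕ.+ Z ≡ p ℕ.* 2
      total = begin
        2 ℕ.* B ℕ.+ R ℕ.+ Z
          ≡⟨ cong (λ t → t ℕ.+ R ℕ.+ Z) (*-distribˡ-∑ p 2 nonsquare) ⟨
        ∑[ x < p ] (2 ℕ.* nonsquare x) ℕ.+ R ℕ.+ Z
          ≡⟨ cong (ℕ._+ Z) (∑-distrib-+ p (λ x → 2 ℕ.* nonsquare x) root-count) ⟨
        ∑[ x < p ] (2 ℕ.* nonsquare x ℕ.+ root-count x) ℕ.+ Z
          ≡⟨ ∑-distrib-+ p (λ x → 2 ℕ.* nonsquare x ℕ.+ root-count x) divisible ⟨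
        ∑[ x < p ] (2 ℕ.* nonsquare x ℕ.+ root-count x ℕ.+ divisible x)
          ≡⟨ ∑-cong p (λ {x} _ → roots-balance p-prime p>2 (+ x * + x + u)) ⟩
        ∑[ x < p ] 2
          ≡⟨ ∑-const p 2 ⟩
        p ℕ.* 2  ∎
      cast : 2 ℕ.* B ℕ.+ R ℕ.+ Z ≡ p ℕ.* 2 → + 2 * + B + + R + + Z ≡ + p * + 2
      cast eq = begin
        + 2 * + B + + R + + Z    ≡⟨ cong (λ t → t + + R + + Z) (pos-* 2 B) ⟨
        + (2 ℕ.* B) + + R + + Z  ≡⟨ cong (_+ + Z) (pos-+ (2 ℕ.* B) R) ⟨
        + (2 ℕ.* B ℕ.+ R) + + Z  ≡⟨ pos-+ (2 ℕ.* B ℕ.+ R) Z ⟨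
        + (2 ℕ.* B ℕ.+ R ℕ.+ Z)  ≡⟨ cong +_ eq ⟩
        + (p ℕ.* 2)              ≡⟨ pos-* p 2 ⟩
        + p * + 2                ∎
      double-negation : ∀ s u → s + u ≡ s - - u
      double-negation = solve-∀
      Z≡roots : Z ≡ roots p-prime (- u)
      Z≡roots = count-cong (λ x → + p ∣? + x * + x + u) (λ y → + p ∣? + y * + y - - u) p
        (λ {x} _ → subst (λ a → (+ p ∣ + x * + x + u) ⇔ (+ p ∣ a)) (double-negation (+ x * + x) u) ⇔-refl)

-- Imported only here: these names clash with the ℕ operators and signed divisibility used above.
open import Data.Nat using (ℕ; suc; _^_)
open import Data.Nat.Primality using (Prime)
open import Data.Integer using (ℤ; +_; -_; _-_; _*_)
open import Data.Integer.Divisibility using (_∣_)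
open import Data.Integer.Divisibility.Signed using (∣⇒∣ᵤ)
open import Data.Product using (Σ; _×_; _,_)
open import Function.Base using (_∘_)
open import Relation.Nullary using (¬_)
open import Relation.Binary.PropositionalEquality using (_≡_)

lemma4 : (p : ℕ) → Prime p → 3 Data.Nat.≤ p → (u : ℤ) → ¬ ((+ p) ∣ u) →
    Σ (ℕ → ℕ) λ S →
      ((v : ℕ) → HasCount p u v (S v))
      × ((ε : ℤ) → Legendre p (- u) ε → + 2 * + (S 0) ≡ + p - ε)
      × S 1 ≡ p
      × ((v : ℕ) → S (suc (suc v)) ≡ p Data.Nat.* S v)
lemma4 p p-prime p>2 u p∤u = S , hasCount , S₀ , S₁ , S-step
  where open Residues.BadResidues p-prime p>2 {u} (p∤u ∘ ∣⇒∣ᵤ)
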